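{- Define $\delta_n\in\mathbb{Z}/2[t]$ for odd $n>0$ by $\delta_1=\delta_3=\delta_5=0$, $\delta_7=t^3$ and $\delta_{n+8}=t^8\delta_n+t^2\delta_{n+2}$. Then, writing $t^n=[a,b]$: if $a>0$, $\delta_n$ is a sum of monomials preceding $[a-1,b]$; if $a=0$, $\delta_n$ is a sum of monomials each equal to or preceding $[0,b-1]$.
   Context: Let $g:\mathbb{N}\to\mathbb{N}$ be defined by $g(0)=0$, $g(2n)=4g(n)$, $g(2n+1)=g(2n)+1$. For $a,b\in\mathbb{N}$, $[a,b]$ denotes $t^{1+2g(a)+4g(b)}$; every $t^k$ with $k$ odd positive is uniquely of this form. Say $[c,d]$ precedes $[a,b]$ if $c+d<a+b$, or $c+d=a+b$ and $d<b$. "A sum of monomials" means a finite (possibly empty, i.e. $0$) sum of distinct monomials; when $b=0$ no monomial is equal to or preceding $[0,b-1]$, so the conclusion then means $\delta_n=0$. -}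

module Defs where

open import Data.Nat using (ℕ; zero; suc; _+_; _*_; _∸_; _<_; _/_; _%_)
open import Data.Bool using (Bool; true; false; _xor_)
open import Data.Product using (_×_; Σ)
open import Data.Sum using (_⊎_)
open import Relation.Binary.PropositionalEquality using (_≡_)

-- g(0)=0, g(2n)=4g(n), g(2n+1)=g(2n)+1, computed with fuel
-- (fuel n suffices since n has at most n binary digits).
gFuel : ℕ → ℕ → ℕ
gFuel zero    n = 0
gFuel (suc f) n = 4 * gFuel f (n / 2) + n % 2

g : ℕ → ℕ
g n = gFuel n n

-- [a,b] is the exponent 1 + 2 g(a) + 4 g(b), i.e. [a,b] = t^(enc a b)
enc : ℕ → ℕ → ℕ
enc a b = 1 + 2 * g a + 4 * g b

Precedes : ℕ → ℕ → ℕ → ℕ → Set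
Precedes c d a b = (c + d < a + b) ⊎ ((c + d ≡ a + b) × (d < b))

-- Polynomials over Z/2 as coefficient functions: p k = coefficient of t^k.
Poly : Set
Poly = ℕ → Bool

zeroP : Poly
zeroP _ = false

mono : ℕ → Poly
mono zero    zero    = true
mono zero    (suc k) = false
mono (suc m) zero    = false
mono (suc m) (suc k) = mono m k

_+P_ : Poly → Poly → Poly
(p +P q) k = p k xor q k

shift : ℕ → Poly → Poly
shift zero    p k       = p k
shift (suc s) p zero    = false
shift (suc s) p (suc k) = shift s p k

-- δ_n (only odd n are meaningful; even n are set to 0 and never used)
δ : ℕ → Poly
δ 7 = mono 3
δ (suc (suc (suc (suc (suc (suc (suc (suc n)))))))) =
  shift 8 (δ n) +P shift 2 (δ (suc (suc n)))
δ _ = zeroP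

-- monomial t^k with k = [c,d] equal to or preceding [0,b-1]
-- (impossible when b = 0)
EqOrPrecedesZeroPred : ℕ → ℕ → ℕ → Set
EqOrPrecedesZeroPred b c d =
  Σ ℕ (λ b' → (b ≡ suc b') × (((c ≡ 0) × (d ≡ b')) ⊎ Precedes c d 0 b'))

-- The monomials of δ_n lie on the lattice n = 7 + 6i + 8j, k = 3 + 2i + 8j, with coefficient
-- the binomial coefficient (i+j choose i) mod 2; by Lucas' theorem it is odd exactly when i and j
-- share no binary digit.  Since g a + 2 g b interleaves the binary digits of a and b, writing
-- t^n = [a,b] and t^k = [c,d] makes (a,b) and (c,d) the de-interleaved binary expansions of
-- 3i + 4j + 3 and i + 4j + 1.  Adding these digit by digit, a finite automaton on the pair of
-- carries maintains  c + d + 1 ≤ a + b  and  c + 2d + 2 ≤ a + 2b,  which is the claimed precedence.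

module Submission where

open import Defs
open import Data.Nat using (ℕ; zero; suc)
open import Data.Bool using (true)
open import Data.Product using (_×_; Σ)
open import Relation.Binary.PropositionalEquality using (_≡_)

open import Data.Nat using (_+_; _*_; _≤_; _<_; _∸_; _/_; _%_; _≟_; _≤?_; z≤n; s≤s; s≤s⁻¹)
open import Data.Nat.Properties
open import Data.Nat.DivMod
open import Data.Nat.Induction using (<-rec)
open import Data.Nat.Tactic.RingSolver using (solve-∀)
open import Data.Bool using (Bool; false; not; _xor_)
open import Data.Bool.Properties using (xor-same; xor-comm; xor-identityʳ)
open import Data.Product using (_,_; proj₁; proj₂)
open import Data.Sum using (_⊎_; inj₁; inj₂; [_,_]′)
open import Data.Empty using (⊥-elim)
open import Function using (_∘_)
open import Relation.Nullary using (¬_; Dec)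
open import Relation.Nullary.Decidable using (True; toWitness; _×-dec_)
open import Relation.Binary.PropositionalEquality using (refl; sym; trans; cong; cong₂; subst; subst₂; module ≡-Reasoning)

-- Binary digits and the interleaving g a + 2 g b

n≡n%2+2*[n/2] : ∀ n → n ≡ n % 2 + 2 * (n / 2)
n≡n%2+2*[n/2] n = trans (m≡m%n+[m/n]*n n 2) (cong (n % 2 +_) (*-comm (n / 2) 2))

[r+2x]%2≡r : ∀ {r} x → r < 2 → (r + 2 * x) % 2 ≡ r
[r+2x]%2≡r {r} x r<2 = begin
  (r + 2 * x) % 2 ≡⟨ cong (λ y → (r + y) % 2) (*-comm 2 x) ⟩
  (r + x * 2) % 2 ≡⟨ [m+kn]%n≡m%n r x 2 ⟩
  r % 2           ≡⟨ m<n⇒m%n≡m r<2 ⟩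
  r               ∎
  where open ≡-Reasoning

[r+2x]/2≡x : ∀ {r} x → r < 2 → (r + 2 * x) / 2 ≡ x
[r+2x]/2≡x {r} x r<2 = begin
  (r + 2 * x) / 2     ≡⟨ cong (λ y → (r + y) / 2) (*-comm 2 x) ⟩
  (r + x * 2) / 2     ≡⟨ +-distrib-/ r (x * 2) no-carry ⟩
  r / 2 + x * 2 / 2   ≡⟨ cong₂ _+_ (m<n⇒m/n≡0 r<2) (m*n/n≡m x 2) ⟩
  x                   ∎
  where
  open ≡-Reasoning
  no-carry : r % 2 + x * 2 % 2 < 2
  no-carry = subst (_< 2) (sym (cong₂ _+_ (m<n⇒m%n≡m r<2) (m*n%n≡0 x 2)))
                   (subst (_< 2) (sym (+-identityʳ r)) r<2)

binary-digits-unique : ∀ {r s x y} → r < 2 → s < 2 → r + 2 * x ≡ s + 2 * y → r ≡ s × x ≡ y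
binary-digits-unique {r} {s} {x} {y} r<2 s<2 eq =
  trans (sym ([r+2x]%2≡r x r<2)) (trans (cong (_% 2) eq) ([r+2x]%2≡r y s<2)) ,
  trans (sym ([r+2x]/2≡x x r<2)) (trans (cong (_/ 2) eq) ([r+2x]/2≡x y s<2))

n%2<2 : ∀ n → n % 2 < 2
n%2<2 n = m%n<n n 2

[1+n]/2<1+n : ∀ n → suc n / 2 < suc n
[1+n]/2<1+n n = m/n<m (suc n) 2 (s≤s (s≤s z≤n))

binary-rec : (P : ℕ → Set) → P 0 → (∀ n → P (suc n / 2) → P (suc n)) → ∀ n → P n
binary-rec P base step = <-rec P rec
  where
  rec : ∀ n → (∀ {m} → m < n → P m) → P n
  rec zero    _  = base
  rec (suc n) ih = step n (ih ([1+n]/2<1+n n))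

gFuel-zero : ∀ f → gFuel f 0 ≡ 0
gFuel-zero zero    = refl
gFuel-zero (suc f) rewrite gFuel-zero f = refl

n≤1+f⇒n/2≤f : ∀ {n f} → n ≤ suc f → n / 2 ≤ f
n≤1+f⇒n/2≤f {zero}  _   = z≤n
n≤1+f⇒n/2≤f {suc n} n≤ = s≤s⁻¹ (≤-trans ([1+n]/2<1+n n) n≤)

gFuel-stable : ∀ {f f' n} → n ≤ f → n ≤ f' → gFuel f n ≡ gFuel f' n
gFuel-stable {zero}  {f'}     z≤n _   = sym (gFuel-zero f')
gFuel-stable {suc f} {zero}   _   z≤n = gFuel-zero (suc f)
gFuel-stable {suc f} {suc f'} {n} p q =
  cong (λ x → 4 * x + n % 2) (gFuel-stable (n≤1+f⇒n/2≤f p) (n≤1+f⇒n/2≤f q))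

g-unfold : ∀ n → g n ≡ n % 2 + 4 * g (n / 2)
g-unfold zero    = refl
g-unfold (suc n) = begin
  4 * gFuel n (suc n / 2) + suc n % 2 ≡⟨ cong (λ x → 4 * x + suc n % 2) (gFuel-stable {n} {suc n / 2} (n≤1+f⇒n/2≤f ≤-refl) ≤-refl) ⟩
  4 * g (suc n / 2) + suc n % 2       ≡⟨ +-comm (4 * g (suc n / 2)) _ ⟩
  suc n % 2 + 4 * g (suc n / 2)       ∎
  where open ≡-Reasoning

n≤g[n] : ∀ n → n ≤ g n
n≤g[n] = binary-rec (λ n → n ≤ g n) z≤n step
  where
  step : ∀ n → suc n / 2 ≤ g (suc n / 2) → suc n ≤ g (suc n)
  step n ih = begin
    suc n                           ≡⟨ n≡n%2+2*[n/2] (suc n) ⟩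
    suc n % 2 + 2 * (suc n / 2)     ≤⟨ +-monoʳ-≤ (suc n % 2) (*-mono-≤ (≤-refl {2}) ih) ⟩
    suc n % 2 + 2 * g (suc n / 2)   ≤⟨ +-monoʳ-≤ (suc n % 2) (*-monoˡ-≤ (g (suc n / 2)) (m≤m+n 2 2)) ⟩
    suc n % 2 + 4 * g (suc n / 2)   ≡⟨ sym (g-unfold (suc n)) ⟩
    g (suc n)                       ∎
    where open ≤-Reasoning

interleave : ℕ → ℕ → ℕ
interleave a b = g a + 2 * g b

enc≡1+2*interleave : ∀ a b → enc a b ≡ 1 + 2 * interleave a b
enc≡1+2*interleave a b = regroup (g a) (g b)
  where
  regroup : ∀ x y → 1 + 2 * x + 4 * y ≡ 1 + 2 * (x + 2 * y)
  regroup = solve-∀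

interleave-unfold : ∀ a b → interleave a b ≡ a % 2 + 2 * interleave b (a / 2)
interleave-unfold a b = trans (cong (_+ 2 * g b) (g-unfold a)) (regroup (a % 2) (g (a / 2)) (g b))
  where
  regroup : ∀ r x y → (r + 4 * x) + 2 * y ≡ r + 2 * (y + 2 * x)
  regroup = solve-∀

interleave-digit : ∀ a b {r X} → r < 2 → interleave a b ≡ r + 2 * X →
                   a ≡ r + 2 * (a / 2) × interleave b (a / 2) ≡ X
interleave-digit a b r<2 eq
  with binary-digits-unique (n%2<2 a) r<2 (trans (sym (interleave-unfold a b)) eq)
... | a%2≡r , rest = trans (n≡n%2+2*[n/2] a) (cong (_+ 2 * (a / 2)) a%2≡r) , rest

interleave-surjective : ∀ n → Σ ℕ (λ a → Σ ℕ (λ b → interleave a b ≡ n))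
interleave-surjective = binary-rec _ (0 , 0 , refl) step
  where
  step : ∀ n → Σ ℕ (λ a → Σ ℕ (λ b → interleave a b ≡ suc n / 2)) →
         Σ ℕ (λ a → Σ ℕ (λ b → interleave a b ≡ suc n))
  step n (a , b , eq) = r + 2 * b , a , (begin
    interleave (r + 2 * b) a                                  ≡⟨ interleave-unfold (r + 2 * b) a ⟩
    (r + 2 * b) % 2 + 2 * interleave a ((r + 2 * b) / 2)      ≡⟨ cong₂ (λ u v → u + 2 * interleave a v)
                                                                   ([r+2x]%2≡r b r<2) ([r+2x]/2≡x b r<2) ⟩
    r + 2 * interleave a b                                    ≡⟨ cong (λ x → r + 2 * x) eq ⟩
    r + 2 * (suc n / 2)                                       ≡⟨ sym (n≡n%2+2*[n/2] (suc n)) ⟩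
    suc n                                                     ∎)
    where
    open ≡-Reasoning
    r = suc n % 2
    r<2 = n%2<2 (suc n)

interleave≡0 : ∀ {a b} → interleave a b ≡ 0 → a ≡ 0 × b ≡ 0
interleave≡0 {a} {b} eq =
  n≤0⇒n≡0 (≤-trans (n≤g[n] a) (≤-trans (m≤m+n (g a) (2 * g b)) (≤-reflexive eq))) ,
  n≤0⇒n≡0 (≤-trans (n≤g[n] b) (≤-trans (m≤n*m (g b) 2) (≤-trans (m≤n+m (2 * g b) (g a)) (≤-reflexive eq))))

parity-digit : ∀ n → n ≡ 0 + 2 * (n / 2) ⊎ n ≡ 1 + 2 * (n / 2)
parity-digit n with n % 2 | n%2<2 n | n≡n%2+2*[n/2] n
... | 0           | _             | eq = inj₁ eq
... | 1           | _             | eq = inj₂ eq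
... | suc (suc _) | s≤s (s≤s ()) | _

-- Pascal's triangle mod 2

-- pascal i j is the binomial coefficient (i+j choose i) mod 2.
pascal : ℕ → ℕ → Bool
pascal zero    j       = true
pascal (suc i) zero    = true
pascal (suc i) (suc j) = pascal i (suc j) xor pascal (suc i) j

-- Lucas' theorem at p = 2.
LucasBlock : ℕ → ℕ → Bool → Set
LucasBlock x y v =
  pascal x y ≡ v × pascal (suc x) y ≡ v × pascal x (suc y) ≡ v × pascal (suc x) (suc y) ≡ false

private
  double : ℕ → ℕ
  double zero    = zero
  double (suc n) = suc (suc (double n))

  double≡2* : ∀ n → double n ≡ 2 * n
  double≡2* zero    = refl
  double≡2* (suc n) = trans (cong (λ x → suc (suc x)) (double≡2* n)) (sym (*-distribˡ-+ 2 1 n))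

  pascal-1-double : ∀ j → pascal 1 (double j) ≡ true
  pascal-1-double zero    = refl
  pascal-1-double (suc j) rewrite pascal-1-double j = refl

  pascal-double-1 : ∀ i → pascal (double i) 1 ≡ true
  pascal-double-1 zero    = refl
  pascal-double-1 (suc i) rewrite pascal-double-1 i = refl

  lucas-double : ∀ i j → LucasBlock (double i) (double j) (pascal i j)
  lucas-double zero    j       = refl , pascal-1-double j , refl , cong not (pascal-1-double j)
  lucas-double (suc i) zero    = refl , refl , pascal-double-1 (suc i) , cong (_xor true) (pascal-double-1 (suc i))
  lucas-double (suc i) (suc j) = ee , oe , eo , oo
    where
    left  = lucas-double i (suc j)
    below = lucas-double (suc i) j
    v     = pascal (suc i) (suc j)
    ee : pascal (double (suc i)) (double (suc j)) ≡ v
    ee = cong₂ _xor_ (proj₁ (proj₂ left)) (proj₁ (proj₂ (proj₂ below)))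
    oe : pascal (suc (double (suc i))) (double (suc j)) ≡ v
    oe = trans (cong₂ _xor_ ee (proj₂ (proj₂ (proj₂ below)))) (xor-identityʳ v)
    eo : pascal (double (suc i)) (suc (double (suc j))) ≡ v
    eo = cong₂ _xor_ (proj₂ (proj₂ (proj₂ left))) ee
    oo : pascal (suc (double (suc i))) (suc (double (suc j))) ≡ false
    oo = trans (cong₂ _xor_ eo oe) (xor-same v)

lucas : ∀ i j → LucasBlock (2 * i) (2 * j) (pascal i j)
lucas i j = subst₂ (λ x y → LucasBlock x y (pascal i j)) (double≡2* i) (double≡2* j) (lucas-double i j)

-- The binary digits of (i, j) at one position; (1, 1) is excluded by Lucas' theorem.
data DigitPair : Set where
  d00 d10 d01 : DigitPair

ε η : DigitPair → ℕ
ε d10 = 1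
ε _   = 0
η d01 = 1
η _   = 0

pascal-digits : ∀ {i j} → pascal i j ≡ true →
  Σ DigitPair (λ d → i ≡ ε d + 2 * (i / 2) × j ≡ η d + 2 * (j / 2) × pascal (i / 2) (j / 2) ≡ true)
pascal-digits {i} {j} odd = digits (parity-digit i) (parity-digit j) (lucas (i / 2) (j / 2))
  where
  i′ = i / 2
  j′ = j / 2
  odd-at : ∀ {x y} → i ≡ x → j ≡ y → pascal x y ≡ true
  odd-at ei ej = subst₂ (λ x y → pascal x y ≡ true) ei ej odd
  digits : i ≡ 0 + 2 * i′ ⊎ i ≡ 1 + 2 * i′ → j ≡ 0 + 2 * j′ ⊎ j ≡ 1 + 2 * j′ →
           LucasBlock (2 * i′) (2 * j′) (pascal i′ j′) →
           Σ DigitPair (λ d → i ≡ ε d + 2 * i′ × j ≡ η d + 2 * j′ × pascal i′ j′ ≡ true)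
  digits (inj₁ ei) (inj₁ ej) (ee , _ , _ , _) = d00 , ei , ej , trans (sym ee) (odd-at ei ej)
  digits (inj₂ ei) (inj₁ ej) (_ , oe , _ , _) = d10 , ei , ej , trans (sym oe) (odd-at ei ej)
  digits (inj₁ ei) (inj₂ ej) (_ , _ , eo , _) = d01 , ei , ej , trans (sym eo) (odd-at ei ej)
  digits (inj₂ ei) (inj₂ ej) (_ , _ , _ , oo) with () ← trans (sym oo) (odd-at ei ej)

-- The support and coefficients of δ

shift-support : ∀ {P : ℕ → Set} s p k → shift s p k ≡ true → (∀ k₀ → p k₀ ≡ true → P (s + k₀)) → P k
shift-support zero    p k       pk P-shifted = P-shifted k pk
shift-support {P} (suc s) p (suc k) pk P-shifted = shift-support {P ∘ suc} s p k pk P-shifted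

mono-support : ∀ m k → mono m k ≡ true → k ≡ m
mono-support zero    zero    _  = refl
mono-support (suc m) (suc k) mk = cong suc (mono-support m k mk)

index degree : ℕ → ℕ → ℕ
index  i j = 7 + 6 * i + 8 * j
degree i j = 3 + 2 * i + 8 * j

index-sucˡ : ∀ i j → index (suc i) j ≡ 6 + index i j
index-sucˡ = ring
  where
  ring : ∀ i j → 7 + 6 * suc i + 8 * j ≡ 6 + (7 + 6 * i + 8 * j)
  ring = solve-∀

degree-sucˡ : ∀ i j → degree (suc i) j ≡ 2 + degree i j
degree-sucˡ = ring
  where
  ring : ∀ i j → 3 + 2 * suc i + 8 * j ≡ 2 + (3 + 2 * i + 8 * j)
  ring = solve-∀

index-sucʳ : ∀ i j → index i (suc j) ≡ 8 + index i j
index-sucʳ = ring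
  where
  ring : ∀ i j → 7 + 6 * i + 8 * suc j ≡ 8 + (7 + 6 * i + 8 * j)
  ring = solve-∀

degree-sucʳ : ∀ i j → degree i (suc j) ≡ 8 + degree i j
degree-sucʳ = ring
  where
  ring : ∀ i j → 3 + 2 * i + 8 * suc j ≡ 8 + (3 + 2 * i + 8 * j)
  ring = solve-∀

OnLattice : ℕ → ℕ → Set
OnLattice n k = Σ ℕ (λ i → Σ ℕ (λ j → n ≡ index i j × k ≡ degree i j))

xor-true : ∀ x y → x xor y ≡ true → x ≡ true ⊎ y ≡ true
xor-true true  _ _  = inj₁ refl
xor-true false _ eq = inj₂ eq

lattice-up : ∀ {n k} → OnLattice n k → OnLattice (8 + n) (8 + k)
lattice-up (i , j , refl , refl) = i , suc j , sym (index-sucʳ i j) , sym (degree-sucʳ i j)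

lattice-right : ∀ {n k} → OnLattice (2 + n) k → OnLattice (8 + n) (2 + k)
lattice-right (i , j , n≡ , refl) = suc i , j , trans (cong (6 +_) n≡) (sym (index-sucˡ i j)) , sym (degree-sucˡ i j)

δ-support : ∀ n k → δ n k ≡ true → OnLattice n k
δ-support 7 k δk = 0 , 0 , refl , mono-support 3 k δk
δ-support (suc (suc (suc (suc (suc (suc (suc (suc n)))))))) k δk =
  [ (λ δk₈ → shift-support {OnLattice (8 + n)} 8 (δ n) k δk₈ (λ k₀ → lattice-up ∘ δ-support n k₀))
  , (λ δk₂ → shift-support {OnLattice (8 + n)} 2 (δ (2 + n)) k δk₂ (λ k₀ → lattice-right ∘ δ-support (suc (suc n)) k₀))
  ]′ (xor-true (shift 8 (δ n) k) _ δk)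

δ-support-bounds : ∀ {n k} → δ n k ≡ true → k + 4 ≤ n × n + 2 ≤ 3 * k
δ-support-bounds {n} {k} δk with δ-support n k δk
... | i , j , refl , refl =
  ≤-trans (m≤m+n _ (4 * i)) (≤-reflexive (sym (index≡ i j))) ,
  ≤-trans (m≤m+n _ (16 * j)) (≤-reflexive (sym (3*degree≡ i j)))
  where
  index≡ : ∀ i j → 7 + 6 * i + 8 * j ≡ (3 + 2 * i + 8 * j + 4) + 4 * i
  index≡ = solve-∀
  3*degree≡ : ∀ i j → 3 * (3 + 2 * i + 8 * j) ≡ (7 + 6 * i + 8 * j + 2) + 16 * j
  3*degree≡ = solve-∀

δ-vanishes : ∀ n k → ¬ (k + 4 ≤ n × n + 2 ≤ 3 * k) → δ n k ≡ false
δ-vanishes n k off-bounds with δ n k in δk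
... | false = refl
... | true  = ⊥-elim (off-bounds (δ-support-bounds δk))

δ-on-lattice : ∀ i j → δ (index i j) (degree i j) ≡ pascal i j
δ-on-lattice zero zero = refl
δ-on-lattice zero (suc j) = begin
  δ (index 0 (suc j)) (degree 0 (suc j))     ≡⟨ cong₂ δ (index-sucʳ 0 j) (degree-sucʳ 0 j) ⟩
  δ (index 0 j) (degree 0 j) xor δ n k       ≡⟨ cong₂ _xor_ (δ-on-lattice 0 j) (δ-vanishes n k too-low) ⟩
  true                                       ∎
  where
  open ≡-Reasoning
  n = 2 + index 0 j
  k = 6 + degree 0 j
  too-low : ¬ (k + 4 ≤ n × n + 2 ≤ 3 * k)
  too-low (k+4≤n , _) = m+1+n≰m (8 * j) (+-cancelˡ-≤ 9 (8 * j + 4) (8 * j) k+4≤n)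
δ-on-lattice (suc zero) zero = refl
δ-on-lattice (suc (suc zero)) zero = refl
δ-on-lattice (suc (suc (suc i))) zero = begin
  δ (index (3 + i) 0) (degree (3 + i) 0)              ≡⟨ cong₂ δ (index≡ i) (degree≡ i) ⟩
  δ n k xor δ (2 + n) (6 + k)                         ≡⟨ cong₂ _xor_ (δ-vanishes n k too-high)
                                                           (cong₂ δ (sym (index≡′ i)) (sym (degree≡′ i))) ⟩
  false xor δ (index (2 + i) 0) (degree (2 + i) 0)    ≡⟨ δ-on-lattice (suc (suc i)) zero ⟩
  true                                                ∎
  where
  open ≡-Reasoning
  n = 17 + 6 * i
  k = 1 + 2 * i
  index≡ : ∀ i → 7 + 6 * (3 + i) + 8 * 0 ≡ 8 + (17 + 6 * i)
  index≡ = solve-∀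
  degree≡ : ∀ i → 3 + 2 * (3 + i) + 8 * 0 ≡ 8 + (1 + 2 * i)
  degree≡ = solve-∀
  index≡′ : ∀ i → 7 + 6 * (2 + i) + 8 * 0 ≡ 2 + (17 + 6 * i)
  index≡′ = solve-∀
  degree≡′ : ∀ i → 3 + 2 * (2 + i) + 8 * 0 ≡ 6 + (1 + 2 * i)
  degree≡′ = solve-∀
  n+2≡ : ∀ i → 17 + 6 * i + 2 ≡ 3 + 6 * i + 16
  n+2≡ = solve-∀
  3k≡ : ∀ i → 3 * (1 + 2 * i) ≡ 3 + 6 * i
  3k≡ = solve-∀
  too-high : ¬ (k + 4 ≤ n × n + 2 ≤ 3 * k)
  too-high (_ , n+2≤3k) = m+1+n≰m (3 + 6 * i) (subst₂ _≤_ (n+2≡ i) (3k≡ i) n+2≤3k)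
δ-on-lattice (suc i) (suc j) = begin
  δ (index (suc i) (suc j)) (degree (suc i) (suc j))
    ≡⟨ cong₂ δ (index-sucʳ (suc i) j) (degree-sucʳ (suc i) j) ⟩
  δ (index (suc i) j) (degree (suc i) j) xor δ (2 + index (suc i) j) (6 + degree (suc i) j)
    ≡⟨ cong₂ _xor_ (δ-on-lattice (suc i) j) (trans (cong₂ δ index≡ degree≡) (δ-on-lattice i (suc j))) ⟩
  pascal (suc i) j xor pascal i (suc j)
    ≡⟨ xor-comm (pascal (suc i) j) (pascal i (suc j)) ⟩
  pascal (suc i) (suc j)
    ∎
  where
  open ≡-Reasoning
  index≡ : 2 + index (suc i) j ≡ index i (suc j)
  index≡ = trans (cong (2 +_) (index-sucˡ i j)) (sym (index-sucʳ i j))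
  degree≡ : 6 + degree (suc i) j ≡ degree i (suc j)
  degree≡ = trans (cong (6 +_) (degree-sucˡ i j)) (sym (degree-sucʳ i j))

-- Adding with carries

-- S p q is the state with carry p in the running sum 3i + 4j and carry q in i + 4j.
data State : Set where
  S00 S10 S11 S20 S21 S22 S31 S32 S33 : State

carryN carryM : State → ℕ
carryN S00 = 0
carryN S10 = 1
carryN S11 = 1
carryN S20 = 2
carryN S21 = 2
carryN S22 = 2
carryN S31 = 3
carryN S32 = 3
carryN S33 = 3
carryM S00 = 0
carryM S10 = 0
carryM S11 = 1
carryM S20 = 0
carryM S21 = 1
carryM S22 = 2
carryM S31 = 1
carryM S32 = 2
carryM S33 = 3

-- Unreachable carry pairs are sent to S00; Transition checks that this never happens.
toState : ℕ → ℕ → State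
toState 1 0 = S10
toState 1 1 = S11
toState 2 0 = S20
toState 2 1 = S21
toState 2 2 = S22
toState 3 1 = S31
toState 3 2 = S32
toState 3 3 = S33
toState _ _ = S00

columnN columnM : State → DigitPair → ℕ
columnN s d = carryN s + 3 * ε d + 4 * η d
columnM s d = carryM s + ε d + 4 * η d

next : State → DigitPair → State
next s d = toState (columnN s d / 2) (columnM s d / 2)

γ κ : State → ℕ
γ S10 = 1
γ S20 = 1
γ S31 = 1
γ S32 = 1
γ _   = 0
κ s = carryN s ∸ carryM s

Dominates : State → ℕ → ℕ → ℕ → ℕ → Set
Dominates s a b c e = c + e + γ s ≤ a + b × c + 2 * e + κ s ≤ a + 2 * b

Transition : State → DigitPair → Set
Transition s d =
  columnN s d / 2 ≡ carryN (next s d) × columnM s d / 2 ≡ carryM (next s d) ×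
  γ s + columnM s d % 2 ≤ κ (next s d) + columnN s d % 2 ×
  κ s + columnM s d % 2 ≤ 2 * γ (next s d) + columnN s d % 2

transition? : ∀ s d → Dec (Transition s d)
transition? s d =
  (columnN s d / 2 ≟ carryN (next s d)) ×-dec (columnM s d / 2 ≟ carryM (next s d)) ×-dec
  (γ s + columnM s d % 2 ≤? κ (next s d) + columnN s d % 2) ×-dec
  (κ s + columnM s d % 2 ≤? 2 * γ (next s d) + columnN s d % 2)

transitions? : ∀ s → Dec (Transition s d00 × Transition s d10 × Transition s d01)
transitions? s = transition? s d00 ×-dec transition? s d10 ×-dec transition? s d01

all-transitions : ∀ s → True (transitions? s)
all-transitions S00 = _
all-transitions S10 = _
all-transitions S11 = _
all-transitions S20 = _
all-transitions S21 = _
all-transitions S22 = _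
all-transitions S31 = _
all-transitions S32 = _
all-transitions S33 = _

transition : ∀ s d → Transition s d
transition s d00 = proj₁ (toWitness (all-transitions s))
transition s d10 = proj₁ (proj₂ (toWitness (all-transitions s)))
transition s d01 = proj₂ (proj₂ (toWitness (all-transitions s)))

settles : ∀ s → next (next s d00) d00 ≡ S00
settles S00 = refl
settles S10 = refl
settles S11 = refl
settles S20 = refl
settles S21 = refl
settles S22 = refl
settles S31 = refl
settles S32 = refl
settles S33 = refl

add-and-cancel : ∀ {x₁ y₁ x₂ y₂ l r m} → x₁ ≤ y₁ → x₂ ≤ y₂ → x₁ + x₂ ≡ l + m → y₁ + y₂ ≡ r + m → l ≤ r
add-and-cancel {m = m} h₁ h₂ el er = +-cancelʳ-≤ m _ _ (subst₂ _≤_ el er (+-mono-≤ h₁ h₂))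

DominatesFrom : State → ℕ → ℕ → Set
DominatesFrom s N M = ∀ a b c e → interleave a b ≡ N → interleave c e ≡ M → Dominates s a b c e

-- Interleaving swaps the two coordinates at every digit, so each inequality of Dominates
-- at the next state yields the other one at the current state.
dominates-step : ∀ s d {X Y} → DominatesFrom (next s d) X Y →
                 DominatesFrom s (columnN s d % 2 + 2 * X) (columnM s d % 2 + 2 * Y)
dominates-step s d ih a b c e eN eM
  with interleave-digit a b (n%2<2 (columnN s d)) eN | interleave-digit c e (n%2<2 (columnM s d)) eM
     | transition s d
... | a≡ , eN′ | c≡ , eM′ | _ , _ , slack₁ , slack₂ with ih b (a / 2) e (c / 2) eN′ eM′
... | ih₁ , ih₂ = subst₂ (λ a c → Dominates s a b c e) (sym a≡) (sym c≡)
  ( add-and-cancel ih₂ slack₁ (ring₁ e (c / 2) (κ (next s d)) (γ s) rM) (ring₂ b (a / 2) (κ (next s d)) rN)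
  , add-and-cancel (*-monoʳ-≤ 2 ih₁) slack₂ (ring₃ e (c / 2) (γ (next s d)) (κ s) rM) (ring₄ b (a / 2) (γ (next s d)) rN) )
  where
  rN = columnN s d % 2
  rM = columnM s d % 2
  ring₁ : ∀ e c′ k g r → (e + 2 * c′ + k) + (g + r) ≡ (r + 2 * c′) + e + g + k
  ring₁ = solve-∀
  ring₂ : ∀ b a′ k r → (b + 2 * a′) + (k + r) ≡ (r + 2 * a′) + b + k
  ring₂ = solve-∀
  ring₃ : ∀ e c′ g k r → 2 * (e + c′ + g) + (k + r) ≡ (r + 2 * c′) + 2 * e + k + 2 * g
  ring₃ = solve-∀
  ring₄ : ∀ b a′ g r → 2 * (b + a′) + (2 * g + r) ≡ (r + 2 * a′) + 2 * b + 2 * g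
  ring₄ = solve-∀

split-column : ∀ col rest {carry} → col / 2 ≡ carry → col + 2 * rest ≡ col % 2 + 2 * (rest + carry)
split-column col rest refl = trans (cong (_+ 2 * rest) (n≡n%2+2*[n/2] col)) (ring (col % 2) (col / 2) rest)
  where
  ring : ∀ r q x → (r + 2 * q) + 2 * x ≡ r + 2 * (x + q)
  ring = solve-∀

DominatesAt : State → ℕ → ℕ → Set
DominatesAt s i j = DominatesFrom s (3 * i + 4 * j + carryN s) (i + 4 * j + carryM s)

carry-step : ∀ s d {i j} → DominatesAt (next s d) i j → DominatesAt s (ε d + 2 * i) (η d + 2 * j)
carry-step s d {i} {j} ih with transition s d
... | carryN≡ , carryM≡ , _ = subst₂ (DominatesFrom s) (sym splitN) (sym splitM) (dominates-step s d ih)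
  where
  ringN : ∀ x y i j p → 3 * (x + 2 * i) + 4 * (y + 2 * j) + p ≡ (p + 3 * x + 4 * y) + 2 * (3 * i + 4 * j)
  ringN = solve-∀
  ringM : ∀ x y i j q → (x + 2 * i) + 4 * (y + 2 * j) + q ≡ (q + x + 4 * y) + 2 * (i + 4 * j)
  ringM = solve-∀
  splitN : 3 * (ε d + 2 * i) + 4 * (η d + 2 * j) + carryN s ≡
           columnN s d % 2 + 2 * (3 * i + 4 * j + carryN (next s d))
  splitN = trans (ringN (ε d) (η d) i j (carryN s)) (split-column (columnN s d) (3 * i + 4 * j) carryN≡)
  splitM : (ε d + 2 * i) + 4 * (η d + 2 * j) + carryM s ≡
           columnM s d % 2 + 2 * (i + 4 * j + carryM (next s d))
  splitM = trans (ringM (ε d) (η d) i j (carryM s)) (split-column (columnM s d) (i + 4 * j) carryM≡)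

settled : DominatesAt S00 0 0
settled a b c e _ eM with interleave≡0 {c} {e} eM
... | refl , refl = z≤n , z≤n

-- With no digits left, two steps with digits 0 flush every carry.
settle : ∀ s → DominatesAt s 0 0
settle s = carry-step s d00 {0} {0} (carry-step (next s d00) d00 {0} {0}
  (subst (λ t → DominatesAt t 0 0) (sym (settles s)) settled))

carry-dominates : ∀ F s {i j} → i ≤ F → j ≤ F → pascal i j ≡ true → DominatesAt s i j
carry-dominates zero    s z≤n z≤n _ = settle s
carry-dominates (suc F) s {i} {j} i≤ j≤ odd with pascal-digits {i} {j} odd
... | d , i≡ , j≡ , odd′ = subst₂ (DominatesAt s) (sym i≡) (sym j≡) (carry-step s d {i / 2} {j / 2}
  (carry-dominates F (next s d) {i / 2} {j / 2} (n≤1+f⇒n/2≤f i≤) (n≤1+f⇒n/2≤f j≤) odd′))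

-- Precedence

δ-monomial-dominated : ∀ A B k → δ (enc A B) k ≡ true →
  Σ ℕ (λ c → Σ ℕ (λ d → k ≡ enc c d × Dominates S31 A B c d))
δ-monomial-dominated A B k δk with δ-support (enc A B) k δk
... | i , j , AB≡ , refl with interleave-surjective (i + 4 * j + 1)
... | c , d , cd≡ =
  -- the constant terms 3 and 1 are the initial carries, i.e. the state S31
  c , d , k≡ , carry-dominates (i + j) S31 (m≤m+n i j) (m≤n+m j i) odd A B c d interleaveAB≡ cd≡
  where
  ringN : ∀ i j → 7 + 6 * i + 8 * j ≡ 1 + 2 * (3 * i + 4 * j + 3)
  ringN = solve-∀
  ringK : ∀ i j → 3 + 2 * i + 8 * j ≡ 1 + 2 * (i + 4 * j + 1)
  ringK = solve-∀
  odd : pascal i j ≡ true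
  odd = trans (sym (δ-on-lattice i j)) (subst (λ n → δ n (degree i j) ≡ true) AB≡ δk)
  interleaveAB≡ : interleave A B ≡ 3 * i + 4 * j + 3
  interleaveAB≡ = *-cancelˡ-≡ _ _ 2 (suc-injective (trans (sym (enc≡1+2*interleave A B)) (trans AB≡ (ringN i j))))
  k≡ : degree i j ≡ enc c d
  k≡ = trans (ringK i j) (trans (cong (λ x → 1 + 2 * x) (sym cd≡)) (sym (enc≡1+2*interleave c d)))

dominates⇒precedes : ∀ a b c d → Dominates S31 (suc a) b c d → Precedes c d a b
dominates⇒precedes a b c d (sum≤ , weighted≤) with m≤n⇒m<n∨m≡n (s≤s⁻¹ (subst (_≤ suc a + b) (+-comm (c + d) 1) sum≤))
... | inj₁ sum< = inj₁ sum<
... | inj₂ sum≡ = inj₂ (sum≡ , s≤s⁻¹ (+-cancelˡ-≤ (a + b) _ _ (subst₂ _≤_ lhs≡ (ring₂ a b) weighted≤)))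
  where
  ring₁ : ∀ c d → c + 2 * d + 2 ≡ (c + d) + suc (suc d)
  ring₁ = solve-∀
  ring₂ : ∀ a b → suc a + 2 * b ≡ (a + b) + suc b
  ring₂ = solve-∀
  lhs≡ : c + 2 * d + 2 ≡ (a + b) + suc (suc d)
  lhs≡ = trans (ring₁ c d) (cong (_+ suc (suc d)) sum≡)

dominates⇒eqOrPrecedesZeroPred : ∀ b c d → Dominates S31 0 b c d → EqOrPrecedesZeroPred b c d
dominates⇒eqOrPrecedesZeroPred b c d (sum≤ , _) with subst (_≤ b) (+-comm (c + d) 1) sum≤
dominates⇒eqOrPrecedesZeroPred (suc b) c d _ | s≤s sum≤b with m≤n⇒m<n∨m≡n sum≤b
... | inj₁ sum< = b , refl , inj₂ (inj₁ sum<)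
... | inj₂ sum≡ with m≤n⇒m<n∨m≡n (subst (d ≤_) sum≡ (m≤n+m d c))
...   | inj₁ d< = b , refl , inj₂ (inj₂ (sum≡ , d<))
...   | inj₂ d≡ = b , refl , inj₁ (+-cancelʳ-≡ d c 0 (trans sum≡ (sym d≡)) , d≡)

corollary3p6 : ((a b k : ℕ) → δ (enc (suc a) b) k ≡ true →
    Σ ℕ (λ c → Σ ℕ (λ d → (k ≡ enc c d) × Precedes c d a b)))
    ×
    ((b k : ℕ) → δ (enc zero b) k ≡ true →
    Σ ℕ (λ c → Σ ℕ (λ d → (k ≡ enc c d) × EqOrPrecedesZeroPred b c d)))
corollary3p6 =
  (λ a b k δk → let c , d , k≡ , dom = δ-monomial-dominated (suc a) b k δk
                in c , d , k≡ , dominates⇒precedes a b c d dom) ,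
  (λ b k δk → let c , d , k≡ , dom = δ-monomial-dominated zero b k δk
              in c , d , k≡ , dominates⇒eqOrPrecedesZeroPred b c d dom)
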